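{- Let $G$ be a graph of order $n$ that has a PSD forcing set $B$ of size $k$ such that $\max_{C\in\mathrm{comp}(G-B)}|V(C)|>\left\lceil\frac{n-k}{2}\right\rceil$. Then there exists a PSD forcing set $B'$ of $G$ such that $|B'|=k$ and $\max_{C\in\mathrm{comp}(G-B')}|V(C)|<\max_{C\in\mathrm{comp}(G-B)}|V(C)|$.
   Context: Graphs are finite and simple; $\mathrm{comp}(H)$ denotes the set of connected components of a graph $H$, and $G-S$ is the subgraph obtained by deleting the vertices of $S$. PSD color change rule: let $B$ be the current set of blue vertices and let $W_1,\dots,W_r$ be the vertex sets of the components of $G-B$; if $u\in B$, $w\in W_i$, and $w$ is the only white neighbor of $u$ in $G[W_i\cup B]$, then $w$ may be colored blue. A set $B\subseteq V(G)$ is a PSD forcing set if starting with exactly $B$ blue, repeated application of the rule colors all of $V(G)$ blue. -}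

module Defs where

open import Data.Nat using (ℕ; zero; suc; _≤_)
open import Data.Bool using (Bool; true; false)
open import Data.Fin using (Fin)
open import Data.Fin.Subset using (Subset; _∈_; _∉_; ⁅_⁆; _∪_; ⊤; ∣_∣)
open import Data.Product using (Σ; ∃; _×_; _,_)
open import Data.Sum using (_⊎_)
open import Relation.Binary.PropositionalEquality using (_≡_)
open import Relation.Binary.Construct.Closure.ReflexiveTransitive using (Star)
open import Function.Bundles using (_⇔_)

record Graph (n : ℕ) : Set where
  field
    adj   : Fin n → Fin n → Bool
    sym   : ∀ u v → adj u v ≡ adj v u
    irrefl : ∀ v → adj v v ≡ false
open Graph public

Adj : ∀ {n} → Graph n → Fin n → Fin n → Set
Adj G u v = adj G u v ≡ true

data Reach {n : ℕ} (G : Graph n) (B : Subset n) : Fin n → Fin n → Set where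
  here  : ∀ {x} → x ∉ B → Reach G B x x
  there : ∀ {x y z} → x ∉ B → Adj G x y → Reach G B y z → Reach G B x z

IsComponent : ∀ {n} → Graph n → Subset n → Subset n → Set
IsComponent G B C = Σ _ λ v → v ∉ B × (∀ x → (x ∈ C) ⇔ Reach G B v x)

MaxCompSize : ∀ {n} → Graph n → Subset n → ℕ → Set
MaxCompSize {n} G B m =
  ((Σ (Subset n) λ C → IsComponent G B C × ∣ C ∣ ≡ m) ⊎ ((∀ v → v ∈ B) × m ≡ 0))
  × (∀ C → IsComponent G B C → ∣ C ∣ ≤ m)

data PSDStep {n : ℕ} (G : Graph n) : Subset n → Subset n → Set where
  force : ∀ {B u w} → u ∈ B → w ∉ B → Adj G u w →
          (∀ x → x ∉ B → Adj G u x → Reach G B w x → x ≡ w) →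
          PSDStep G B (⁅ w ⁆ ∪ B)

IsPSDForcingSet : ∀ {n} → Graph n → Subset n → Set
IsPSDForcingSet G B = Star (PSDStep G) B ⊤

{-# OPTIONS --safe #-}
module Submission where

-- Let C be a largest component of G − B. Follow a forcing process from B up to the first
-- force u → w into C: at that moment C is still entirely white, so u ∈ B and w is the only
-- neighbour of u in C. Swap them, B′ = B − u + w. Then w can force u back, after which the
-- blue set is B ∪ {w}, so B′ is again a PSD forcing set of the same size. In G − B′ no edge
-- joins C to the rest (u sees only w in C), so a component of G − B′ lies either in C − w,
-- of order < |C|, or outside C among the n − k + 1 vertices not in B − u; in the latter
-- case its order is at most n − k + 1 − |C| < |C| because |C| > ⌈(n − k)/2⌉.

open import Defs renaming (sym to adj-sym)
open import Data.Nat using (ℕ; zero; suc; _+_; _∸_; _≤_; _<_; z≤n; s≤s; ⌈_/2⌉)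
open import Data.Nat.Properties hiding (_≟_)
open import Data.Bool using (true; false)
open import Data.Bool.Properties using () renaming (_≟_ to _≟ᵇ_)
open import Data.Vec using ([]; _∷_; tabulate; here; there)
open import Data.Vec.Properties using (lookup⇒[]=; []=⇒lookup; lookup∘tabulate)
open import Data.Fin using (Fin; _≟_)
open import Data.Fin.Subset using (Subset; _∈_; _∉_; _⊆_; _∪_; _─_; _-_; ⁅_⁆; ∁; ∣_∣)
open import Data.Fin.Subset.Properties
open import Data.Fin.Properties using (any?; all?; ¬∀⟶∃¬)
open import Data.List using (allFin)
open import Data.List.Membership.Propositional.Properties using (∈-allFin)
import Data.List.Relation.Unary.All as All
open import Data.List.Extrema ≤-totalOrder using (argmax; f[⊥]≤f[argmax]; f[xs]≤f[argmax])
open import Data.Product using (Σ; ∃; _×_; _,_; proj₁; proj₂)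
open import Data.Sum using (_⊎_; inj₁; inj₂; [_,_]′; fromInj₂)
open import Data.Empty using (⊥-elim)
open import Function using (_∘_)
open import Function.Bundles using (_⇔_; mk⇔; Equivalence)
open import Relation.Nullary using (¬_; Dec; yes; no; does; contradiction)
open import Relation.Nullary.Decidable using (_×-dec_) renaming (map to Dec-map)
open import Relation.Unary using (Decidable)
open import Relation.Binary.PropositionalEquality
open import Relation.Binary.Construct.Closure.ReflexiveTransitive using (ε; _◅_)

private
  variable
    n : ℕ

∪-least : {p q r : Subset n} → p ⊆ r → q ⊆ r → p ∪ q ⊆ r
∪-least {p = p} {q} p⊆r q⊆r = [ p⊆r , q⊆r ]′ ∘ x∈p∪q⁻ p q

x∉⁅y⁆∪p : {x y : Fin n} {p : Subset n} → x ≢ y → x ∉ p → x ∉ ⁅ y ⁆ ∪ p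
x∉⁅y⁆∪p {y = y} {p} x≢y x∉p = [ x≢y ∘ x∈⁅y⁆⇒x≡y y , x∉p ]′ ∘ x∈p∪q⁻ ⁅ y ⁆ p

x∈p─q⇒x∉q : {x : Fin n} (p q : Subset n) → x ∈ p ─ q → x ∉ q
x∈p─q⇒x∉q (_ ∷ p) (true ∷ q) () here
x∈p─q⇒x∉q (_ ∷ p) (_ ∷ q) (there x∈p─q) (there x∈q) = x∈p─q⇒x∉q p q x∈p─q x∈q

x∈p⇒⁅x⁆⊆p : {x : Fin n} {p : Subset n} → x ∈ p → ⁅ x ⁆ ⊆ p
x∈p⇒⁅x⁆⊆p {x = x} {p = p} x∈p y∈⁅x⁆ = subst (_∈ p) (sym (x∈⁅y⁆⇒x≡y x y∈⁅x⁆)) x∈p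

⁅x⁆∪[p-x]≡p : {x : Fin n} {p : Subset n} → x ∈ p → ⁅ x ⁆ ∪ (p - x) ≡ p
⁅x⁆∪[p-x]≡p {x = x} {p = p} x∈p = ⊆-antisym
  (∪-least (x∈p⇒⁅x⁆⊆p x∈p) (p─q⊆p p ⁅ x ⁆))
  p⊆⁅x⁆∪[p-x]
  where
  p⊆⁅x⁆∪[p-x] : p ⊆ ⁅ x ⁆ ∪ (p - x)
  p⊆⁅x⁆∪[p-x] {y} y∈p with y ≟ x
  ... | yes refl = x∈p∪q⁺ (inj₁ (x∈⁅x⁆ x))
  ... | no y≢x = x∈p∪q⁺ (inj₂ (x∈p∧x≢y⇒x∈p-y y∈p y≢x))

∣p∪q∣≡∣p∣+∣q∣ : (p q : Subset n) → (∀ {x} → x ∈ p → x ∉ q) → ∣ p ∪ q ∣ ≡ ∣ p ∣ + ∣ q ∣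
∣p∪q∣≡∣p∣+∣q∣ [] [] _ = refl
∣p∪q∣≡∣p∣+∣q∣ (s ∷ p) (t ∷ q) disjoint
  with ∣p∪q∣≡∣p∣+∣q∣ p q (λ x∈p x∈q → disjoint (there x∈p) (there x∈q))
∣p∪q∣≡∣p∣+∣q∣ (false ∷ p) (false ∷ q) _ | ih = ih
∣p∪q∣≡∣p∣+∣q∣ (true ∷ p) (false ∷ q) _ | ih = cong suc ih
∣p∪q∣≡∣p∣+∣q∣ (false ∷ p) (true ∷ q) _ | ih = trans (cong suc ih) (sym (+-suc ∣ p ∣ ∣ q ∣))
∣p∪q∣≡∣p∣+∣q∣ (true ∷ p) (true ∷ q) disjoint | _ = ⊥-elim (disjoint here here)

∣⁅x⁆∪p∣≡1+∣p∣ : {x : Fin n} {p : Subset n} → x ∉ p → ∣ ⁅ x ⁆ ∪ p ∣ ≡ suc ∣ p ∣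
∣⁅x⁆∪p∣≡1+∣p∣ {x = x} {p = p} x∉p = trans
  (∣p∪q∣≡∣p∣+∣q∣ ⁅ x ⁆ p (λ y∈⁅x⁆ → x∉p ∘ subst (_∈ p) (x∈⁅y⁆⇒x≡y x y∈⁅x⁆)))
  (cong (_+ ∣ p ∣) (∣⁅x⁆∣≡1 x))

∣p∣≡1+∣p-x∣ : {x : Fin n} {p : Subset n} → x ∈ p → ∣ p ∣ ≡ suc ∣ p - x ∣
∣p∣≡1+∣p-x∣ {x = x} {p = p} x∈p = trans
  (cong ∣_∣ (sym (⁅x⁆∪[p-x]≡p x∈p)))
  (∣⁅x⁆∪p∣≡1+∣p∣ (λ x∈p-x → x∈p─q⇒x∉q p ⁅ x ⁆ x∈p-x (x∈⁅x⁆ x)))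

x∈p⇒0<∣p∣ : {x : Fin n} {p : Subset n} → x ∈ p → 0 < ∣ p ∣
x∈p⇒0<∣p∣ x∈p = ≤-<-trans z≤n (x∈p⇒∣p-x∣<∣p∣ x∈p)

∈-tabulate⇔ : {P : Fin n → Set} (P? : Decidable P) {x : Fin n} →
  x ∈ tabulate (does ∘ P?) ⇔ P x
∈-tabulate⇔ P? {x} with P? x | lookup∘tabulate (does ∘ P?) x
... | yes px | lookup≡true = mk⇔ (λ _ → px) (λ _ → lookup⇒[]= x _ lookup≡true)
... | no ¬px | lookup≡false =
  mk⇔ (λ x∈ → contradiction (trans (sym lookup≡false) ([]=⇒lookup x∈)) λ ())
      (λ px → contradiction px ¬px)

a+m≤1+x∧⌈x/2⌉<m⇒a<m : ∀ {a m x} → a + m ≤ suc x → ⌈ x /2⌉ < m → a < m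
a+m≤1+x∧⌈x/2⌉<m⇒a<m {a} {m} {x} a+m≤1+x h<m = +-cancelʳ-< m a m (begin-strict
  a + m        ≤⟨ a+m≤1+x ⟩
  suc x        ≤⟨ s≤s x≤h+h ⟩
  suc (h + h)  ≤⟨ +-monoˡ-≤ h h<m ⟩
  m + h        <⟨ +-monoʳ-< m h<m ⟩
  m + m        ∎)
  where
  open ≤-Reasoning
  h = ⌈ x /2⌉
  x≤h+h : x ≤ h + h
  x≤h+h = subst (_≤ h + h) (⌊n/2⌋+⌈n/2⌉≡n x) (+-monoˡ-≤ h (⌊n/2⌋≤⌈n/2⌉ x))

module _ (G : Graph n) where

  Adj-sym : ∀ {x y} → Adj G x y → Adj G y x
  Adj-sym {x} {y} xy = trans (adj-sym G y x) xy

  Adj? : ∀ x y → Dec (Adj G x y)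
  Adj? x y = adj G x y ≟ᵇ true

  reach-start : ∀ {D a x} → Reach G D a x → a ∉ D
  reach-start (here a∉D) = a∉D
  reach-start (there a∉D _ _) = a∉D

  reach-end : ∀ {D a x} → Reach G D a x → x ∉ D
  reach-end (here x∉D) = x∉D
  reach-end (there _ _ r) = reach-end r

  reach-trans : ∀ {D a b c} → Reach G D a b → Reach G D b c → Reach G D a c
  reach-trans (here _) r = r
  reach-trans (there a∉D e r) r′ = there a∉D e (reach-trans r r′)

  reach-snoc : ∀ {D a b c} → Reach G D a b → Adj G b c → c ∉ D → Reach G D a c
  reach-snoc r e c∉D = reach-trans r (there (reach-end r) e (here c∉D))

  reach-sym : ∀ {D a b} → Reach G D a b → Reach G D b a
  reach-sym (here a∉D) = here a∉D
  reach-sym (there a∉D e r) = reach-snoc (reach-sym r) (Adj-sym e) a∉D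

  reach-antitone : ∀ {D E a b} → D ⊆ E → Reach G E a b → Reach G D a b
  reach-antitone D⊆E (here a∉E) = here (a∉E ∘ D⊆E)
  reach-antitone D⊆E (there a∉E e r) = there (a∉E ∘ D⊆E) e (reach-antitone D⊆E r)

  reach-restrict : ∀ {D E a x} → Reach G D a x → (∀ {y} → Reach G D a y → y ∉ E) →
    Reach G E a x
  reach-restrict (here a∉D) avoids = here (avoids (here a∉D))
  reach-restrict (there a∉D e r) avoids =
    there (avoids (here a∉D)) e (reach-restrict r (avoids ∘ there a∉D e))

  reach-last-exit : ∀ {D a x} v → Reach G D a x → x ≢ v →
    Reach G (⁅ v ⁆ ∪ D) a x ⊎ ∃ λ y → Adj G v y × Reach G (⁅ v ⁆ ∪ D) y x
  reach-last-exit v (here x∉D) x≢v = inj₁ (here (x∉⁅y⁆∪p x≢v x∉D))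
  reach-last-exit {a = a} v (there {y = b} a∉D e r) x≢v
    with reach-last-exit v r x≢v | a ≟ v
  ... | inj₂ exit | _ = inj₂ exit
  ... | inj₁ r′ | yes refl = inj₂ (b , e , r′)
  ... | inj₁ r′ | no a≢v = inj₁ (there (x∉⁅y⁆∪p a≢v a∉D) e r′)

  reach-via-neighbour⇔ : ∀ {D a x} → a ∉ D → a ≢ x →
    (∃ λ y → Adj G a y × Reach G (⁅ a ⁆ ∪ D) y x) ⇔ Reach G D a x
  reach-via-neighbour⇔ {D} {a} a∉D a≢x = mk⇔
    (λ (y , e , r) → there a∉D e (reach-antitone (q⊆p∪q ⁅ a ⁆ D) r))
    (λ r → fromInj₂ (λ r′ → contradiction (x∈p∪q⁺ (inj₁ (x∈⁅x⁆ a))) (reach-start r′))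
                    (reach-last-exit a r (a≢x ∘ sym)))

  -- Each recursive call adds the start vertex to D, so n ∸ ∣ D ∣ steps suffice.
  reach? : ∀ fuel D → n ≤ fuel + ∣ D ∣ → ∀ a x → Dec (Reach G D a x)
  reach? fuel D n≤ a x with a ∈? D | a ≟ x
  ... | yes a∈D | _ = no λ r → reach-start r a∈D
  ... | no a∉D | yes refl = yes (here a∉D)
  ... | no a∉D | no a≢x with fuel
  ...   | zero = contradiction
                   (subst (_≤ ∣ D ∣) (∣⁅x⁆∪p∣≡1+∣p∣ a∉D) (≤-trans (∣p∣≤n (⁅ a ⁆ ∪ D)) n≤))
                   (<-irrefl refl)
  ...   | suc fuel = Dec-map (reach-via-neighbour⇔ a∉D a≢x)
                       (any? λ y → Adj? a y ×-dec reach? fuel (⁅ a ⁆ ∪ D) n≤′ y x)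
    where
    n≤′ : n ≤ fuel + ∣ ⁅ a ⁆ ∪ D ∣
    n≤′ = subst (n ≤_) (sym (trans (cong (fuel +_) (∣⁅x⁆∪p∣≡1+∣p∣ a∉D)) (+-suc fuel ∣ D ∣))) n≤

  component : Subset n → Fin n → Subset n
  component D v = tabulate (does ∘ reach? n D (m≤m+n n ∣ D ∣) v)

  ∈component⇔ : ∀ {D v x} → x ∈ component D v ⇔ Reach G D v x
  ∈component⇔ {D} {v} = ∈-tabulate⇔ (reach? n D (m≤m+n n ∣ D ∣) v)

  ∣component∣≡0 : ∀ {D v} → v ∈ D → ∣ component D v ∣ ≡ 0
  ∣component∣≡0 v∈D = trans
    (cong ∣_∣ (Empty-unique λ (_ , x∈) → reach-start (Equivalence.to ∈component⇔ x∈) v∈D))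
    (∣⊥∣≡0 n)

  0<∣component∣ : ∀ {D v} → v ∉ D → 0 < ∣ component D v ∣
  0<∣component∣ v∉D = x∈p⇒0<∣p∣ (Equivalence.from ∈component⇔ (here v∉D))

  -- C is a union of components of G − D.
  Separates : Subset n → Subset n → Set
  Separates D C = ∀ {p q} → p ∉ D → q ∉ D → p ∉ C → q ∈ C → ¬ Adj G p q

  reach-stays-in : ∀ {D C a z} → Separates D C → Reach G D a z → a ∈ C → z ∈ C
  reach-stays-in sep (here _) a∈C = a∈C
  reach-stays-in {C = C} sep (there {y = b} a∉D e r) a∈C with b ∈? C
  ... | yes b∈C = reach-stays-in sep r b∈C
  ... | no b∉C = contradiction (Adj-sym e) (sep (reach-start r) a∉D b∉C a∈C)

  reach-stays-out : ∀ {D C a z} → Separates D C → Reach G D a z → a ∉ C → z ∉ C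
  reach-stays-out sep r a∉C z∈C = a∉C (reach-stays-in sep (reach-sym r) z∈C)

  Forces : Subset n → Fin n → Fin n → Set
  Forces B u w =
    u ∈ B × w ∉ B × Adj G u w × (∀ x → x ∉ B → Adj G u x → Reach G B w x → x ≡ w)

  force-step : ∀ {B u w} → Forces B u w → PSDStep G B (⁅ w ⁆ ∪ B)
  force-step (u∈B , w∉B , uw , only-w) = force u∈B w∉B uw only-w

  module Component {B C : Subset n} (isC : IsComponent G B C) where

    private
      c = proj₁ isC

    ∈C⇔reach : ∀ {x} → x ∈ C ⇔ Reach G B c x
    ∈C⇔reach {x} = proj₂ (proj₂ isC) x

    c∈C : c ∈ C
    c∈C = Equivalence.from ∈C⇔reach (here (proj₁ (proj₂ isC)))

    ∈C⇒∉B : ∀ {x} → x ∈ C → x ∉ B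
    ∈C⇒∉B = reach-end ∘ Equivalence.to ∈C⇔reach

    C-connected : ∀ {x y} → x ∈ C → y ∈ C → Reach G B x y
    C-connected x∈C y∈C =
      reach-trans (reach-sym (Equivalence.to ∈C⇔reach x∈C)) (Equivalence.to ∈C⇔reach y∈C)

    C-closed : ∀ {x y} → x ∈ C → Reach G B x y → y ∈ C
    C-closed x∈C r = Equivalence.from ∈C⇔reach (reach-trans (Equivalence.to ∈C⇔reach x∈C) r)

    C-closed-Adj : ∀ {x y} → x ∈ C → Adj G x y → y ∉ B → y ∈ C
    C-closed-Adj x∈C e y∉B = C-closed x∈C (there (∈C⇒∉B x∈C) e (here y∉B))

    -- While C is still white, walks from w inside C avoid D, so a force u → w relative to
    -- D is already one relative to B.
    first-force-into : ∀ {D} → B ⊆ D → (∀ {x} → x ∈ C → x ∉ D) → IsPSDForcingSet G D →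
      Σ (Fin n) λ u → Σ (Fin n) λ w → Forces B u w × w ∈ C
    first-force-into B⊆D C∩D=∅ ε = contradiction ∈⊤ (C∩D=∅ c∈C)
    first-force-into {D} B⊆D C∩D=∅ (force {u = u} {w} u∈D w∉D e only ◅ steps) with w ∈? C
    ... | no w∉C = first-force-into (q⊆p∪q ⁅ w ⁆ D ∘ B⊆D) C∩⁅w⁆∪D=∅ steps
      where
      C∩⁅w⁆∪D=∅ : ∀ {x} → x ∈ C → x ∉ ⁅ w ⁆ ∪ D
      C∩⁅w⁆∪D=∅ x∈C = x∉⁅y⁆∪p (λ { refl → w∉C x∈C }) (C∩D=∅ x∈C)
    ... | yes w∈C with u ∈? B
    ...   | no u∉B = contradiction u∈D (C∩D=∅ (C-closed-Adj w∈C (Adj-sym e) u∉B))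
    ...   | yes u∈B = u , w , (u∈B , ∈C⇒∉B w∈C , e , only′) , w∈C
      where
      only′ : ∀ x → x ∉ B → Adj G u x → Reach G B w x → x ≡ w
      only′ x x∉B ux r =
        only x (C∩D=∅ (C-closed w∈C r)) ux (reach-restrict r (C∩D=∅ ∘ C-closed w∈C))

  forcing-⊇ : ∀ {B D} → IsPSDForcingSet G B → B ⊆ D → IsPSDForcingSet G D
  forcing-⊇ ε ⊤⊆D = subst (IsPSDForcingSet G) (⊆-antisym ⊤⊆D ⊆⊤) ε
  forcing-⊇ {D = D} (force {B} {u} {w} u∈B w∉B e only ◅ steps) B⊆D with w ∈? D
  ... | yes w∈D = forcing-⊇ steps (∪-least (x∈p⇒⁅x⁆⊆p w∈D) B⊆D)
  ... | no w∉D =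
    force (B⊆D u∈B) w∉D e (λ x x∉D ux r → only x (x∉D ∘ B⊆D) ux (reach-antitone B⊆D r))
    ◅ forcing-⊇ steps (∪-least (p⊆p∪q D) (q⊆p∪q ⁅ w ⁆ D ∘ B⊆D))

  maxCompSize-exists : ∀ D → ∃ (MaxCompSize G D)
  maxCompSize-exists D with all? (_∈? D)
  ... | yes all∈D =
    0 , inj₂ (all∈D , refl) , λ { K (v , v∉D , _) → contradiction (all∈D v) v∉D }
  ... | no ¬all∈D with ¬∀⟶∃¬ n (_∈ D) (_∈? D) ¬all∈D
  ...   | v₀ , v₀∉D =
    size a , inj₁ (component D a , (a , a∉D , λ _ → ∈component⇔) , refl) , size-bound
    where
    size : Fin n → ℕ
    size v = ∣ component D v ∣
    a : Fin n
    a = argmax size v₀ (allFin n)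
    a∉D : a ∉ D
    a∉D a∈D = <⇒≱
      (<-≤-trans (0<∣component∣ v₀∉D) (f[⊥]≤f[argmax] {f = size} v₀ (allFin n)))
      (≤-reflexive (∣component∣≡0 a∈D))
    size-bound : ∀ K → IsComponent G D K → ∣ K ∣ ≤ size a
    size-bound K (v , _ , K⇔) = ≤-trans
      (p⊆q⇒∣p∣≤∣q∣ (Equivalence.from ∈component⇔ ∘ Equivalence.to (K⇔ _)))
      (All.lookup (f[xs]≤f[argmax] {f = size} v₀ (allFin n)) (∈-allFin v))

  maxCompSize-< : ∀ {D m m′} → MaxCompSize G D m′ → 0 < m →
    (∀ K → IsComponent G D K → ∣ K ∣ < m) → m′ < m
  maxCompSize-< (inj₁ (K , isK , refl) , _) _ all<m = all<m K isK
  maxCompSize-< (inj₂ (_ , refl) , _) 0<m _ = 0<m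

  module Swap {B C : Subset n} (isC : IsComponent G B C) {u w : Fin n}
              (u⇒w : Forces B u w) (w∈C : w ∈ C) where

    open Component isC

    private
      u∈B = proj₁ u⇒w
      w∉B = proj₁ (proj₂ u⇒w)
      uw = proj₁ (proj₂ (proj₂ u⇒w))
      only-w = proj₂ (proj₂ (proj₂ u⇒w))

    B′ : Subset n
    B′ = (⁅ w ⁆ ∪ B) - u

    u∈⁅w⁆∪B : u ∈ ⁅ w ⁆ ∪ B
    u∈⁅w⁆∪B = x∈p∪q⁺ (inj₂ u∈B)

    u∉C : u ∉ C
    u∉C u∈C = ∈C⇒∉B u∈C u∈B

    u∉B′ : u ∉ B′
    u∉B′ u∈B′ = x∈p─q⇒x∉q (⁅ w ⁆ ∪ B) ⁅ u ⁆ u∈B′ (x∈⁅x⁆ u)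

    w∈B′ : w ∈ B′
    w∈B′ = x∈p∧x≢y⇒x∈p-y (x∈p∪q⁺ (inj₁ (x∈⁅x⁆ w))) λ { refl → u∉C w∈C }

    ∉B′⇒≡u⊎∉B : ∀ {x} → x ∉ B′ → x ≡ u ⊎ x ∉ B
    ∉B′⇒≡u⊎∉B {x} x∉B′ with x ≟ u
    ... | yes x≡u = inj₁ x≡u
    ... | no x≢u = inj₂ λ x∈B → x∉B′ (x∈p∧x≢y⇒x∈p-y (x∈p∪q⁺ (inj₂ x∈B)) x≢u)

    ∣B′∣≡∣B∣ : ∣ B′ ∣ ≡ ∣ B ∣
    ∣B′∣≡∣B∣ = suc-injective (trans (sym (∣p∣≡1+∣p-x∣ u∈⁅w⁆∪B)) (∣⁅x⁆∪p∣≡1+∣p∣ w∉B))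

    C-separated : Separates B′ C
    C-separated p∉B′ q∉B′ p∉C q∈C pq with ∉B′⇒≡u⊎∉B p∉B′
    ... | inj₁ refl =
      q∉B′ (subst (_∈ B′) (sym (only-w _ (∈C⇒∉B q∈C) pq (C-connected w∈C q∈C))) w∈B′)
    ... | inj₂ p∉B = p∉C (C-closed-Adj q∈C (Adj-sym pq) p∉B)

    w⇒u : Forces B′ w u
    w⇒u = w∈B′ , u∉B′ , Adj-sym uw , only-u
      where
      only-u : ∀ x → x ∉ B′ → Adj G w x → Reach G B′ u x → x ≡ u
      only-u x x∉B′ wx r with ∉B′⇒≡u⊎∉B x∉B′
      ... | inj₁ x≡u = x≡u
      ... | inj₂ x∉B =
        contradiction (C-closed-Adj w∈C wx x∉B) (reach-stays-out C-separated r u∉C)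

    B′-forcing : IsPSDForcingSet G B → IsPSDForcingSet G B′
    B′-forcing F = force-step w⇒u ◅ subst (IsPSDForcingSet G) (sym (⁅x⁆∪[p-x]≡p u∈⁅w⁆∪B))
                                      (forcing-⊇ F (q⊆p∪q ⁅ w ⁆ B))

    component-smaller : ⌈ (n ∸ ∣ B ∣) /2⌉ < ∣ C ∣ →
      ∀ K → IsComponent G B′ K → ∣ K ∣ < ∣ C ∣
    component-smaller h<∣C∣ K (v , _ , K⇔) with v ∈? C
    ... | yes v∈C =
      p⊂q⇒∣p∣<∣q∣ (K⊆C , w , w∈C , λ w∈K → reach-end (Equivalence.to (K⇔ w) w∈K) w∈B′)
      where
      K⊆C : K ⊆ C
      K⊆C x∈K = reach-stays-in C-separated (Equivalence.to (K⇔ _) x∈K) v∈C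
    ... | no v∉C = a+m≤1+x∧⌈x/2⌉<m⇒a<m (begin
      ∣ K ∣ + ∣ C ∣       ≡⟨ ∣p∪q∣≡∣p∣+∣q∣ K C K∩C=∅ ⟨
      ∣ K ∪ C ∣           ≤⟨ p⊆q⇒∣p∣≤∣q∣ (∪-least K⊆ C⊆) ⟩
      ∣ ⁅ u ⁆ ∪ ∁ B ∣     ≡⟨ ∣⁅x⁆∪p∣≡1+∣p∣ (x∈p⇒x∉∁p u∈B) ⟩
      suc ∣ ∁ B ∣         ≡⟨ cong suc (∣∁p∣≡n∸∣p∣ B) ⟩
      suc (n ∸ ∣ B ∣)     ∎) h<∣C∣
      where
      open ≤-Reasoning
      K∩C=∅ : ∀ {x} → x ∈ K → x ∉ C
      K∩C=∅ x∈K = reach-stays-out C-separated (Equivalence.to (K⇔ _) x∈K) v∉C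
      K⊆ : K ⊆ ⁅ u ⁆ ∪ ∁ B
      K⊆ x∈K with ∉B′⇒≡u⊎∉B (reach-end (Equivalence.to (K⇔ _) x∈K))
      ... | inj₁ refl = x∈p∪q⁺ (inj₁ (x∈⁅x⁆ u))
      ... | inj₂ x∉B = x∈p∪q⁺ (inj₂ (x∉p⇒x∈∁p x∉B))
      C⊆ : C ⊆ ⁅ u ⁆ ∪ ∁ B
      C⊆ x∈C = x∈p∪q⁺ (inj₂ (x∉p⇒x∈∁p (∈C⇒∉B x∈C)))

lemma2p4 : ∀ {n k m} (G : Graph n) (B : Subset n) →
    IsPSDForcingSet G B → ∣ B ∣ ≡ k → MaxCompSize G B m → ⌈ (n ∸ k) /2⌉ < m →
    Σ (Subset n) λ B′ → Σ ℕ λ m′ →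
      IsPSDForcingSet G B′ × ∣ B′ ∣ ≡ k × MaxCompSize G B′ m′ × m′ < m
lemma2p4 G B F refl (inj₂ (_ , refl) , _) ()
lemma2p4 G B F refl (inj₁ (C , isC , refl) , _) h<∣C∣ =
  let open Component G isC
      (u , w , u⇒w , w∈C) = first-force-into (λ x∈B → x∈B) ∈C⇒∉B F
      open Swap G isC u⇒w w∈C
      (m′ , max′) = maxCompSize-exists G B′
  in B′ , m′ , B′-forcing F , ∣B′∣≡∣B∣ , max′ ,
     maxCompSize-< G max′ (≤-<-trans z≤n h<∣C∣) (component-smaller h<∣C∣)
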